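{- Let $F$ be a field and let $B \in F^{n\times n}$ be symmetric. Suppose that $\operatorname{qpr}(B) = q_1 q_2 \cdots q_n$ and that $q_k = {\tt N}$ for some $k$. Then $q_j = {\tt N}$ for all $j \geq k$.
   Context: For an $n\times n$ matrix $B$ and $\alpha,\beta\subseteq\{1,\dots,n\}$, $B[\alpha,\beta]$ denotes the submatrix with rows indexed by $\alpha$ and columns indexed by $\beta$. $B[\alpha,\beta]$ is a quasi-principal submatrix if $|\alpha|=|\beta|$ and $|\alpha|-1\le|\alpha\cap\beta|\le|\alpha|$; its determinant is then a quasi-principal minor of order $|\alpha|$. The quasi principal rank characteristic sequence of a symmetric $B\in F^{n\times n}$ is $\operatorname{qpr}(B)=q_1q_2\cdots q_n$, where $q_k={\tt A}$ if all quasi-principal minors of order $k$ are nonzero, $q_k={\tt S}$ if some but not all are nonzero, and $q_k={\tt N}$ if all are zero. -}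

module Defs where

open import Level using (Level; _⊔_)
open import Algebra.Bundles using (CommutativeRing)
open import Data.Nat using (ℕ; zero; suc; _∸_; _≤_)
open import Data.Fin using (Fin; zero; suc; punchIn; _<_)
open import Data.Fin.Properties using (_≟_; any?)
open import Data.Bool using (if_then_else_)
open import Relation.Nullary using (¬_; does)
open import Data.Product using (Σ; _,_)

record Field (c ℓ : Level) : Set (Level.suc (c ⊔ ℓ)) where
  field
    commutativeRing : CommutativeRing c ℓ
  open CommutativeRing commutativeRing public
  field
    1≉0     : ¬ (1# ≈ 0#)
    inverse : ∀ x → ¬ (x ≈ 0#) → Σ Carrier (λ y → x * y ≈ 1#)

module _ {c ℓ : Level} (F : Field c ℓ) where
  open Field F using (Carrier; _≈_; _+_; _*_; -_; 0#; 1#)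

  Matrix : ℕ → ℕ → Set c
  Matrix m n = Fin m → Fin n → Carrier

  sumFin : ∀ {n} → (Fin n → Carrier) → Carrier
  sumFin {zero}  f = 0#
  sumFin {suc n} f = f zero + sumFin (λ i → f (suc i))

  sign : ∀ {n} → Fin n → Carrier
  sign zero    = 1#
  sign (suc i) = - sign i

  det : ∀ {n} → Matrix n n → Carrier
  det {zero}  A = 1#
  det {suc n} A =
    sumFin (λ j → sign j * (A zero j * det (λ r s → A (suc r) (punchIn j s))))

  Symmetric : ∀ {n} → Matrix n n → Set ℓ
  Symmetric {n} B = ∀ i j → B i j ≈ B j i

  submatrix : ∀ {n k} → Matrix n n → (Fin k → Fin n) → (Fin k → Fin n) → Matrix k k
  submatrix B α β r s = B (α r) (β s)

-- k-subsets of {1..n} are represented by strictly increasing maps Fin k → Fin n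
StrictlyIncreasing : ∀ {k n} → (Fin k → Fin n) → Set
StrictlyIncreasing {k} α = ∀ (i j : Fin k) → i < j → α i < α j

countFin : ∀ {k} → (Fin k → Data.Bool.Bool) → ℕ
countFin {zero}  p = zero
countFin {suc k} p = if p zero then suc (countFin (λ i → p (suc i))) else countFin (λ i → p (suc i))

interSize : ∀ {k n} → (Fin k → Fin n) → (Fin k → Fin n) → ℕ
interSize α β = countFin (λ i → does (any? (λ j → α i ≟ β j)))

QuasiPrincipal : ∀ {k n} → (Fin k → Fin n) → (Fin k → Fin n) → Set
QuasiPrincipal {k} α β = (k ∸ 1 ≤ interSize α β) Data.Product.× (interSize α β ≤ k)

module _ {c ℓ : Level} (F : Field c ℓ) where
  open Field F using (Carrier; _≈_; _+_; _*_; -_; 0#; 1#)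

  -- q_k = N : every quasi-principal minor of order k of B is zero
  qprIsN : ∀ {n} → Matrix F n n → ℕ → Set ℓ
  qprIsN {n} B k =
    ∀ (α β : Fin k → Fin n) → StrictlyIncreasing α → StrictlyIncreasing β →
    QuasiPrincipal α β → det F (submatrix F B α β) ≈ 0#

module Submission where

-- If every quasi-principal minor of order k of an n × n matrix B over a field
-- vanishes, then so does every quasi-principal minor of order k + 1, and hence
-- (by induction) of every order j ≥ k.
--
-- Take B[α,β] quasi-principal of order j + 1, i.e. |α ∩ β| ≥ j.  Choose a row p
-- with α_p ∉ β if one exists, otherwise any row.  Then for every column t the
-- cofactor submatrix B[α∖α_p , β∖β_t] is quasi-principal of order j, so it has
-- zero determinant, and Laplace expansion of det B[α,β] along row p is zero.

open import Defs
open import Level using (Level)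
open import Data.Nat as ℕ using (ℕ; zero; suc; _≤_; _≤′_; z≤n; s≤s)
import Data.Nat.Properties as ℕ
open import Data.Fin using (Fin; zero; suc; punchIn; punchOut)
open import Data.Fin.Properties
  using (_≟_; any?; <-cmp; <⇒≢; ≤∧≢⇒<; punchIn-punchOut; punchInᵢ≢i; punchIn-mono-≤; punchIn-injective)
open import Data.Vec.Functional using (insertAt)
open import Data.Vec.Functional.Properties
  using (insertAt-lookup; insertAt-punchIn; removeAt-insertAt)
open import Data.Bool using (Bool; true; false; if_then_else_)
import Data.Bool.Properties as Bool
open import Data.Product using (Σ; _,_; proj₁; proj₂)
open import Data.Empty using (⊥-elim)
open import Function using (_∘_)
open import Function.Definitions using (Injective)
open import Relation.Nullary using (yes; no)
open import Relation.Nullary.Decidable using (does; dec-true)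
open import Relation.Binary using (tri<; tri≈; tri>)
open import Relation.Binary.PropositionalEquality as ≡ using (_≡_; _≢_; _≗_)

punchIn-punchOut-comm : ∀ {n} {j t : Fin (suc (suc n))} (j≢t : j ≢ t) (t≢j : t ≢ j) →
  punchIn j ∘ punchIn (punchOut j≢t) ≗ punchIn t ∘ punchIn (punchOut t≢j)
punchIn-punchOut-comm {j = zero}  {zero}  j≢t _ _ = ⊥-elim (j≢t ≡.refl)
punchIn-punchOut-comm {j = zero}  {suc t} _ _ _ = ≡.refl
punchIn-punchOut-comm {j = suc j} {zero}  _ _ _ = ≡.refl
punchIn-punchOut-comm {suc n} {suc j} {suc t} _ _ zero = ≡.refl
punchIn-punchOut-comm {suc n} {suc j} {suc t} j≢t t≢j (suc u) =
  ≡.cong suc (punchIn-punchOut-comm (j≢t ∘ ≡.cong suc) (t≢j ∘ ≡.cong suc) u)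

module Determinants {c ℓ : Level} (F : Field c ℓ) where

  open Field F hiding (zero)
  open import Algebra.Properties.Ring ring using (-‿distribˡ-*; -‿distribʳ-*; -‿involutive)
  open import Algebra.Properties.Semiring.Sum semiring
    using (sum; sum-cong-≋; sum-cong-≗; sum-remove; sum-replicate-zero; ∑-comm; *-distribˡ-sum)
  open import Algebra.Solver.CommutativeMonoid *-commutativeMonoid
    using (solve; _⊕_; _⊜_)
  open import Relation.Binary.Reasoning.Setoid setoid

  -- The summation of Defs is the library's finite sum over the additive monoid,
  -- so all of the library's summation lemmas apply to the determinant.
  sumFin≡sum : ∀ {n} (f : Fin n → Carrier) → sumFin F f ≡ sum f
  sumFin≡sum {zero}  f = ≡.refl
  sumFin≡sum {suc n} f = ≡.cong (f zero +_) (sumFin≡sum (f ∘ suc))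

  sum-insertAt-0# : ∀ {n} (f : Fin n → Carrier) (i : Fin (suc n)) →
    sum (insertAt f i 0#) ≈ sum f
  sum-insertAt-0# f i = begin
    sum (insertAt f i 0#)
      ≈⟨ sum-remove {i = i} (insertAt f i 0#) ⟩
    insertAt f i 0# i + sum (insertAt f i 0# ∘ punchIn i)
      ≡⟨ ≡.cong₂ _+_ (insertAt-lookup f i 0#) (sum-cong-≗ (removeAt-insertAt f i 0#)) ⟩
    0# + sum f
      ≈⟨ +-identityˡ (sum f) ⟩
    sum f ∎

  sum-0# : ∀ {n} {f : Fin n → Carrier} → (∀ i → f i ≈ 0#) → sum f ≈ 0#
  sum-0# {n} f≈0 = trans (sum-cong-≋ f≈0) (sum-replicate-zero n)

  ∑-offDiagonal : ∀ {n} (f g : Fin (suc n) → Fin n → Carrier) →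
    (∀ j t (j≢t : j ≢ t) (t≢j : t ≢ j) → f j (punchOut j≢t) ≈ g t (punchOut t≢j)) →
    sum (λ j → sum (f j)) ≈ sum (λ t → sum (g t))
  -- Both sides equal the full double sum with zeros inserted on the diagonal.
  ∑-offDiagonal f g f≈g = begin
    sum (λ j → sum (f j))
      ≈⟨ sum-cong-≋ (λ j → sym (sum-insertAt-0# (f j) j)) ⟩
    sum (λ j → sum (λ t → insertAt (f j) j 0# t))
      ≈⟨ ∑-comm (λ j t → insertAt (f j) j 0# t) ⟩
    sum (λ t → sum (λ j → insertAt (f j) j 0# t))
      ≈⟨ sum-cong-≋ (λ t → sum-cong-≋ (λ j → pairwise j t)) ⟩
    sum (λ t → sum (λ j → insertAt (g t) t 0# j))
      ≈⟨ sum-cong-≋ (λ t → sum-insertAt-0# (g t) t) ⟩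
    sum (λ t → sum (g t)) ∎
    where
    insertAt-punchOut : ∀ {n} (h : Fin n → Carrier) {i j} (i≢j : i ≢ j) →
      insertAt h i 0# j ≡ h (punchOut i≢j)
    insertAt-punchOut h {i} i≢j = ≡.trans
      (≡.cong (insertAt h i 0#) (≡.sym (punchIn-punchOut i≢j)))
      (insertAt-punchIn h i 0# (punchOut i≢j))

    pairwise : ∀ j t → insertAt (f j) j 0# t ≈ insertAt (g t) t 0# j
    pairwise j t with j ≟ t
    ... | yes ≡.refl = reflexive (≡.trans (insertAt-lookup (f j) j 0#)
                                          (≡.sym (insertAt-lookup (g j) j 0#)))
    ... | no j≢t = begin
      insertAt (f j) j 0# t   ≡⟨ insertAt-punchOut (f j) j≢t ⟩
      f j (punchOut j≢t)      ≈⟨ f≈g j t j≢t (j≢t ∘ ≡.sym) ⟩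
      g t (punchOut t≢j)      ≡⟨ insertAt-punchOut (g t) t≢j ⟨
      insertAt (g t) t 0# j   ∎
      where
      t≢j : t ≢ j
      t≢j = j≢t ∘ ≡.sym

  sign-punchOut-antisym : ∀ {n} {j t : Fin (suc (suc n))} (j≢t : j ≢ t) (t≢j : t ≢ j) →
    sign F j * sign F (punchOut j≢t) ≈ - (sign F t * sign F (punchOut t≢j))
  sign-punchOut-antisym {j = zero}  {zero}  j≢t _ = ⊥-elim (j≢t ≡.refl)
  sign-punchOut-antisym {j = zero}  {suc t} _ _ = begin
    1# * sign F t         ≈⟨ *-identityˡ _ ⟩
    sign F t              ≈⟨ -‿involutive _ ⟨
    - - sign F t          ≈⟨ -‿cong (*-identityʳ _) ⟨
    - (- sign F t * 1#)   ∎
  sign-punchOut-antisym {j = suc j} {zero}  _ _ = begin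
    - sign F j * 1#       ≈⟨ *-identityʳ _ ⟩
    - sign F j            ≈⟨ -‿cong (*-identityˡ _) ⟨
    - (1# * sign F j)     ∎
  sign-punchOut-antisym {zero}  {suc zero} {suc zero} j≢t _ = ⊥-elim (j≢t ≡.refl)
  sign-punchOut-antisym {suc n} {suc j} {suc t} j≢t t≢j = begin
    - sign F j * - sign F s      ≈⟨ neg*neg _ _ ⟩
    sign F j * sign F s          ≈⟨ sign-punchOut-antisym (j≢t ∘ ≡.cong suc) (t≢j ∘ ≡.cong suc) ⟩
    - (sign F t * sign F s')     ≈⟨ -‿cong (neg*neg _ _) ⟨
    - (- sign F t * - sign F s') ∎
    where
    s s' : Fin (suc n)
    s = punchOut (j≢t ∘ ≡.cong suc)
    s' = punchOut (t≢j ∘ ≡.cong suc)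
    neg*neg : ∀ x y → - x * - y ≈ x * y
    neg*neg x y = begin
      - x * - y       ≈⟨ -‿distribˡ-* x (- y) ⟨
      - (x * - y)     ≈⟨ -‿cong (-‿distribʳ-* x y) ⟨
      - - (x * y)     ≈⟨ -‿involutive _ ⟩
      x * y           ∎

  minor : ∀ {m} → Matrix F (suc m) (suc m) → Fin (suc m) → Fin (suc m) → Matrix F m m
  minor M p t r s = M (punchIn p r) (punchIn t s)

  det-firstRow : ∀ {m} (M : Matrix F (suc m) (suc m)) →
    det F M ≡ sum (λ j → sign F j * (M zero j * det F (minor M zero j)))
  det-firstRow M = sumFin≡sum (λ j → sign F j * (M zero j * det F (minor M zero j)))

  det-cong : ∀ {n} {A B : Matrix F n n} → (∀ i j → A i j ≈ B i j) → det F A ≈ det F B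
  det-cong {zero}  A≈B = refl
  det-cong {suc n} {A} {B} A≈B = begin
    det F A
      ≡⟨ det-firstRow A ⟩
    sum (λ j → sign F j * (A zero j * det F (minor A zero j)))
      ≈⟨ sum-cong-≋ (λ j → *-congˡ {sign F j} (*-cong (A≈B zero j) (det-cong (λ r s → A≈B (suc r) (punchIn j s))))) ⟩
    sum (λ j → sign F j * (B zero j * det F (minor B zero j)))
      ≡⟨ det-firstRow B ⟨
    det F B ∎

  *-distribˡ-sum₃ : ∀ {n} a b c (h : Fin n → Carrier) →
    a * (b * (c * sum h)) ≈ sum (λ i → a * (b * (c * h i)))
  *-distribˡ-sum₃ a b c h = begin
    a * (b * (c * sum h))                 ≈⟨ *-congˡ (*-congˡ (*-distribˡ-sum c h)) ⟩
    a * (b * sum (λ i → c * h i))         ≈⟨ *-congˡ (*-distribˡ-sum b (λ i → c * h i)) ⟩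
    a * sum (λ i → b * (c * h i))         ≈⟨ *-distribˡ-sum a (λ i → b * (c * h i)) ⟩
    sum (λ i → a * (b * (c * h i)))       ∎

  -- The commutative-ring identity matching one term of the expansion along the
  -- first row with the corresponding term of the expansion along row p + 1.
  exchange-terms : ∀ a b c d e x a' d' → a * d ≈ - (a' * d') →
    a * (b * (c * (d * (e * x)))) ≈ - c * (a' * (e * (d' * (b * x))))
  exchange-terms a b c d e x a' d' ad≈-a'd' = begin
    a * (b * (c * (d * (e * x))))    ≈⟨ solve 6 (λ a b c d e x →
                                          a ⊕ (b ⊕ (c ⊕ (d ⊕ (e ⊕ x)))) ⊜ (c ⊕ (a ⊕ d)) ⊕ (b ⊕ (e ⊕ x)))
                                          refl a b c d e x ⟩
    c * (a * d) * (b * (e * x))      ≈⟨ *-congʳ (*-congˡ ad≈-a'd') ⟩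
    c * - (a' * d') * (b * (e * x))  ≈⟨ *-congʳ (-‿distribʳ-* c _) ⟨
    - (c * (a' * d')) * (b * (e * x)) ≈⟨ *-congʳ (-‿distribˡ-* c _) ⟩
    - c * (a' * d') * (b * (e * x))  ≈⟨ solve 6 (λ c' a' d' b e x →
                                          (c' ⊕ (a' ⊕ d')) ⊕ (b ⊕ (e ⊕ x)) ⊜ c' ⊕ (a' ⊕ (e ⊕ (d' ⊕ (b ⊕ x)))))
                                          refl (- c) a' d' b e x ⟩
    - c * (a' * (e * (d' * (b * x)))) ∎

  -- For row p + 1, expand along the first row and then each first-row
  -- minor along row p (induction); every term now deletes row 0, row p + 1 and two
  -- distinct columns j, t, and ∑-offDiagonal regroups these terms into the
  -- first-row expansions of the minors of row p + 1.
  laplace : ∀ {m} (p : Fin (suc m)) (M : Matrix F (suc m) (suc m)) →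
    det F M ≈ sign F p * sum (λ t → sign F t * (M p t * det F (minor M p t)))
  laplace zero M = trans (reflexive (det-firstRow M)) (sym (*-identityˡ _))
  laplace {suc m} (suc p) M = begin
    det F M
      ≡⟨ det-firstRow M ⟩
    sum (λ j → sign F j * (M zero j * det F (minor M zero j)))
      ≈⟨ sum-cong-≋ expandRow ⟩
    sum (λ j → sum (f j))
      ≈⟨ ∑-offDiagonal f g pair ⟩
    sum (λ t → sum (g t))
      ≈⟨ sum-cong-≋ expandMinor ⟨
    sum (λ t → sign F q * (sign F t * (M q t * det F (minor M q t))))
      ≈⟨ *-distribˡ-sum (sign F q) (λ t → sign F t * (M q t * det F (minor M q t))) ⟨
    sign F q * sum (λ t → sign F t * (M q t * det F (minor M q t))) ∎
    where
    q : Fin (suc (suc m))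
    q = suc p
    D : (Fin m → Fin (suc (suc m))) → Carrier
    D cols = det F (λ r u → M (suc (punchIn p r)) (cols u))
    -- the terms of the row-0-then-row-q expansion (columns j, then s among the rest)
    -- and of the row-q-then-row-0 expansion (columns t, then j' among the rest)
    f : Fin (suc (suc m)) → Fin (suc m) → Carrier
    f j s = sign F j * (M zero j * (sign F p * (sign F s * (M q (punchIn j s) * D (punchIn j ∘ punchIn s)))))
    g : Fin (suc (suc m)) → Fin (suc m) → Carrier
    g t j' = sign F q * (sign F t * (M q t * (sign F j' * (M zero (punchIn t j') * D (punchIn t ∘ punchIn j')))))

    expandRow : ∀ j → sign F j * (M zero j * det F (minor M zero j)) ≈ sum (f j)
    expandRow j = begin
      sign F j * (M zero j * det F (minor M zero j))
        ≈⟨ *-congˡ (*-congˡ (laplace p (minor M zero j))) ⟩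
      sign F j * (M zero j * (sign F p * sum (λ s → sign F s * (M q (punchIn j s) * D (punchIn j ∘ punchIn s)))))
        ≈⟨ *-distribˡ-sum₃ (sign F j) (M zero j) (sign F p)
             (λ s → sign F s * (M q (punchIn j s) * D (punchIn j ∘ punchIn s))) ⟩
      sum (f j) ∎

    expandMinor : ∀ t → sign F q * (sign F t * (M q t * det F (minor M q t))) ≈ sum (g t)
    expandMinor t = begin
      sign F q * (sign F t * (M q t * det F (minor M q t)))
        ≡⟨ ≡.cong (λ d → sign F q * (sign F t * (M q t * d))) (det-firstRow (minor M q t)) ⟩
      sign F q * (sign F t * (M q t * sum (λ j' → sign F j' * (M zero (punchIn t j') * D (punchIn t ∘ punchIn j')))))
        ≈⟨ *-distribˡ-sum₃ (sign F q) (sign F t) (M q t)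
             (λ j' → sign F j' * (M zero (punchIn t j') * D (punchIn t ∘ punchIn j'))) ⟩
      sum (g t) ∎

    pair : ∀ j t (j≢t : j ≢ t) (t≢j : t ≢ j) → f j (punchOut j≢t) ≈ g t (punchOut t≢j)
    pair j t j≢t t≢j = begin
      f j s
        ≡⟨ ≡.cong (λ x → sign F j * (M zero j * (sign F p * (sign F s * (M q x * D (punchIn j ∘ punchIn s))))))
                  (punchIn-punchOut j≢t) ⟩
      sign F j * (M zero j * (sign F p * (sign F s * (M q t * D (punchIn j ∘ punchIn s)))))
        ≈⟨ exchange-terms _ _ _ _ _ _ _ _ (sign-punchOut-antisym j≢t t≢j) ⟩
      sign F q * (sign F t * (M q t * (sign F s' * (M zero j * D (punchIn j ∘ punchIn s)))))
        ≈⟨ *-congˡ (*-congˡ (*-congˡ (*-congˡ (*-cong (reflexive (≡.cong (M zero) (≡.sym (punchIn-punchOut t≢j))))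
                 (det-cong (λ r u → reflexive (≡.cong (M (suc (punchIn p r))) (punchIn-punchOut-comm j≢t t≢j u)))))))) ⟩
      g t s' ∎
      where
      s s' : Fin (suc m)
      s = punchOut j≢t
      s' = punchOut t≢j

countFin-punchIn : ∀ {k} (f : Fin (suc k) → Bool) (p : Fin (suc k)) →
  countFin f ≡ (if f p then suc (countFin (f ∘ punchIn p)) else countFin (f ∘ punchIn p))
countFin-punchIn f zero = ≡.refl
countFin-punchIn {suc k} f (suc p) rewrite countFin-punchIn (f ∘ suc) p with f zero | f (suc p)
... | true  | true  = ≡.refl
... | true  | false = ≡.refl
... | false | true  = ≡.refl
... | false | false = ≡.refl

countFin-punchIn-≤ : ∀ {k} (f : Fin (suc k) → Bool) (p : Fin (suc k)) →
  countFin f ≤ suc (countFin (f ∘ punchIn p))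
countFin-punchIn-≤ f p rewrite countFin-punchIn f p with f p
... | true  = ℕ.≤-refl
... | false = ℕ.n≤1+n _

countFin-punchIn-≥ : ∀ {k} (f : Fin (suc k) → Bool) (p : Fin (suc k)) →
  countFin (f ∘ punchIn p) ≤ countFin f
countFin-punchIn-≥ f p rewrite countFin-punchIn f p with f p
... | true  = ℕ.n≤1+n _
... | false = ℕ.≤-refl

countFin-false : ∀ {k} (f : Fin (suc k) → Bool) (p : Fin (suc k)) → f p ≡ false →
  countFin (f ∘ punchIn p) ≡ countFin f
countFin-false f p fp≡false rewrite countFin-punchIn f p | fp≡false = ≡.refl

countFin-mono : ∀ {k} (f g : Fin k → Bool) → (∀ i → f i ≡ true → g i ≡ true) →
  countFin f ≤ countFin g
countFin-mono {zero}  f g f⇒g = z≤n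
countFin-mono {suc k} f g f⇒g with f zero in f0 | g zero in g0
... | true  | true  = s≤s (countFin-mono (f ∘ suc) (g ∘ suc) (f⇒g ∘ suc))
... | true  | false with () ← ≡.trans (≡.sym g0) (f⇒g zero f0)
... | false | true  = ℕ.m≤n⇒m≤1+n (countFin-mono (f ∘ suc) (g ∘ suc) (f⇒g ∘ suc))
... | false | false = countFin-mono (f ∘ suc) (g ∘ suc) (f⇒g ∘ suc)

countFin-≤ : ∀ {k} (f : Fin k → Bool) → countFin f ≤ k
countFin-≤ {zero}  f = z≤n
countFin-≤ {suc k} f with f zero
... | true  = s≤s (countFin-≤ (f ∘ suc))
... | false = ℕ.m≤n⇒m≤1+n (countFin-≤ (f ∘ suc))

countFin-all : ∀ {k} (f : Fin k → Bool) → (∀ i → f i ≡ true) → countFin f ≡ k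
countFin-all {zero}  f all = ≡.refl
countFin-all {suc k} f all with f zero | all zero
... | true | ≡.refl = ≡.cong suc (countFin-all (f ∘ suc) (all ∘ suc))

isListed : ∀ {k n} → (Fin k → Fin n) → Fin n → Bool
isListed β x = does (any? (λ j → x ≟ β j))

shared : ∀ {k m n} → (Fin m → Fin n) → (Fin k → Fin n) → ℕ
shared α β = countFin (λ i → isListed β (α i))

isListed-witness : ∀ {k n} (β : Fin k → Fin n) x → isListed β x ≡ true → Σ (Fin k) (λ j → x ≡ β j)
isListed-witness β x listed with any? (λ j → x ≟ β j)
... | yes witness = witness
isListed-witness β x () | no _

isListed-punchIn : ∀ {k n} (β : Fin (suc k) → Fin n) (t : Fin (suc k)) x →
  x ≢ β t → isListed β x ≡ true → isListed (β ∘ punchIn t) x ≡ true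
isListed-punchIn β t x x≢βt listed with isListed-witness β x listed
... | j , x≡βj with t ≟ j
...   | yes ≡.refl = ⊥-elim (x≢βt x≡βj)
...   | no t≢j = dec-true (any? (λ i → x ≟ β (punchIn t i)))
                   (punchOut t≢j , ≡.trans x≡βj (≡.cong β (≡.sym (punchIn-punchOut t≢j))))

-- Deleting one column β t lowers the number of indices shared with an injective α
-- by at most one,
-- because at most one row of α lists β t.
shared-punchIn : ∀ {k m n} (α : Fin m → Fin n) (β : Fin (suc k) → Fin n) (t : Fin (suc k)) →
  Injective _≡_ _≡_ α → shared α β ≤ suc (shared α (β ∘ punchIn t))
shared-punchIn {m = zero}  α β t α-inj = z≤n
shared-punchIn {m = suc m} α β t α-inj with any? (λ i → α i ≟ β t)
... | yes (i₀ , αi₀≡βt) = begin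
  shared α β                           ≤⟨ countFin-punchIn-≤ inβ i₀ ⟩
  suc (countFin (inβ ∘ punchIn i₀))     ≤⟨ s≤s (countFin-mono (inβ ∘ punchIn i₀) (inβ' ∘ punchIn i₀) otherRows) ⟩
  suc (countFin (inβ' ∘ punchIn i₀))    ≤⟨ s≤s (countFin-punchIn-≥ inβ' i₀) ⟩
  suc (shared α (β ∘ punchIn t))       ∎
  where
  open ℕ.≤-Reasoning
  inβ inβ' : Fin (suc m) → Bool
  inβ i = isListed β (α i)
  inβ' i = isListed (β ∘ punchIn t) (α i)
  otherRows : ∀ i → inβ (punchIn i₀ i) ≡ true → inβ' (punchIn i₀ i) ≡ true
  otherRows i = isListed-punchIn β t (α (punchIn i₀ i))
    (λ αi≡βt → punchInᵢ≢i i₀ i (α-inj (≡.trans αi≡βt (≡.sym αi₀≡βt))))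
... | no noRow = ℕ.m≤n⇒m≤1+n (countFin-mono _ _ (λ i → isListed-punchIn β t (α i) (λ e → noRow (i , e))))

strictlyIncreasing⇒injective : ∀ {k n} (α : Fin k → Fin n) → StrictlyIncreasing α →
  Injective _≡_ _≡_ α
strictlyIncreasing⇒injective α α↑ {i} {j} αi≡αj with <-cmp i j
... | tri< i<j _ _ = ⊥-elim (<⇒≢ (α↑ i j i<j) αi≡αj)
... | tri≈ _ i≡j _ = i≡j
... | tri> _ _ j<i = ⊥-elim (<⇒≢ (α↑ j i j<i) (≡.sym αi≡αj))

strictlyIncreasing-∘ : ∀ {k m n} (α : Fin m → Fin n) (γ : Fin k → Fin m) →
  StrictlyIncreasing α → StrictlyIncreasing γ → StrictlyIncreasing (α ∘ γ)
strictlyIncreasing-∘ α γ α↑ γ↑ i j i<j = α↑ (γ i) (γ j) (γ↑ i j i<j)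

punchIn-strictlyIncreasing : ∀ {n} (p : Fin (suc n)) → StrictlyIncreasing (punchIn p)
punchIn-strictlyIncreasing p i j i<j =
  ≤∧≢⇒< (punchIn-mono-≤ p i j (ℕ.<⇒≤ i<j)) (<⇒≢ i<j ∘ punchIn-injective p i j)

-- Take p with α_p ∉ β
-- if there is one (deleting it keeps |α ∩ β| ≥ j), otherwise any p (then α ⊆ β);
-- deleting a column then loses at most one common index.
cofactors-quasiPrincipal : ∀ {j n} (α β : Fin (suc j) → Fin n) → Injective _≡_ _≡_ α →
  j ≤ interSize α β → Σ (Fin (suc j)) λ p → ∀ t → QuasiPrincipal (α ∘ punchIn p) (β ∘ punchIn t)
cofactors-quasiPrincipal {j} α β α-inj j≤shared =
  p , λ t → ℕ.∸-monoˡ-≤ 1 (ℕ.≤-trans j≤sharedRow (shared-punchIn (α ∘ punchIn p) β t α'-inj))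
          , countFin-≤ _
  where
  inβ : Fin (suc j) → Bool
  inβ i = isListed β (α i)

  goodRow : Σ (Fin (suc j)) λ p → j ≤ shared (α ∘ punchIn p) β
  goodRow with any? (λ i → inβ i Bool.≟ false)
  ... | yes (p , notListed) = p , ℕ.≤-trans j≤shared (ℕ.≤-reflexive (≡.sym (countFin-false inβ p notListed)))
  ... | no allListed = zero , ℕ.≤-reflexive (≡.sym (countFin-all (inβ ∘ suc) (λ i → Bool.¬-not (λ e → allListed (suc i , e)))))

  p : Fin (suc j)
  p = proj₁ goodRow

  j≤sharedRow : j ≤ shared (α ∘ punchIn p) β
  j≤sharedRow = proj₂ goodRow

  α'-inj : Injective _≡_ _≡_ (α ∘ punchIn p)
  α'-inj e = punchIn-injective p _ _ (α-inj e)

module _ {c ℓ : Level} (F : Field c ℓ) {n : ℕ} (B : Matrix F n n) where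
  open Field F using (_≈_; _*_; 0#; *-congˡ; zeroʳ; setoid; semiring)
  open import Algebra.Properties.Semiring.Sum semiring using (sum)
  open Determinants F using (sum-0#; minor; laplace)
  open import Relation.Binary.Reasoning.Setoid setoid

  qprIsN-suc : ∀ j → qprIsN F B j → qprIsN F B (suc j)
  qprIsN-suc j minors≈0 α β α↑ β↑ (j≤shared , _)
    with cofactors-quasiPrincipal α β (strictlyIncreasing⇒injective α α↑) j≤shared
  ... | p , cofactorsQP = begin
    det F A                                                     ≈⟨ laplace p A ⟩
    sign F p * sum (λ t → sign F t * (A p t * det F (minor A p t))) ≈⟨ *-congˡ (sum-0# cofactor≈0) ⟩
    sign F p * 0#                                               ≈⟨ zeroʳ _ ⟩
    0#                                                          ∎
    where
    A : Matrix F (suc j) (suc j)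
    A = submatrix F B α β

    cofactor≈0 : ∀ t → sign F t * (A p t * det F (minor A p t)) ≈ 0#
    cofactor≈0 t = begin
      sign F t * (A p t * det F (minor A p t))  ≈⟨ *-congˡ (*-congˡ (minors≈0 (α ∘ punchIn p) (β ∘ punchIn t)
                                                      (strictlyIncreasing-∘ α (punchIn p) α↑ (punchIn-strictlyIncreasing p))
                                                      (strictlyIncreasing-∘ β (punchIn t) β↑ (punchIn-strictlyIncreasing t))
                                                      (cofactorsQP t))) ⟩
      sign F t * (A p t * 0#)                   ≈⟨ *-congˡ (zeroʳ _) ⟩
      sign F t * 0#                             ≈⟨ zeroʳ _ ⟩
      0#                                        ∎

  qprIsN-upward : ∀ {k j} → k ≤′ j → qprIsN F B k → qprIsN F B j
  qprIsN-upward (ℕ.≤′-reflexive ≡.refl) minors≈0 = minors≈0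
  qprIsN-upward (ℕ.≤′-step k≤′j)        minors≈0 = qprIsN-suc _ (qprIsN-upward k≤′j minors≈0)

-- Theorem: if q_k = N then q_j = N for every j ≥ k.
mainTheorem3 : ∀ {c ℓ : Level} (F : Field c ℓ) (n : ℕ) (B : Matrix F n n) →
    Symmetric F B →
    (k : ℕ) → 1 ≤ k → k ≤ n → qprIsN F B k →
    (j : ℕ) → k ≤ j → j ≤ n → qprIsN F B j
mainTheorem3 F n B _ k _ _ minors≈0 j k≤j _ = qprIsN-upward F B (ℕ.≤⇒≤′ k≤j) minors≈0
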